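{- Let $d\ge 1$ and let $H$ be a $d$-regular graph that has BEL gadgets, and suppose there is a vertex $v\in V(H)$ such that $N(v)$ is an independent set and $H-v-N(v)$ is connected. Then there exists a graph $G$ containing no copy of $H$, together with an independent set $S\subseteq V(G)$ of size $2d-1$, such that for every set $S'\subseteq S$ of $d$ vertices, the graph obtained from $G$ by adding one new vertex adjacent exactly to the vertices of $S'$ contains a copy of $H$.
   Context: All graphs are finite and simple; a copy of a graph means a (not necessarily induced) subgraph isomorphic to it. $H-v-N(v)$ is the graph obtained from $H$ by deleting $v$ and all its neighbors. For graphs $F,H$, write $F\not\to H$ if some 2-coloring of the edges of $F$ has no monochromatic copy of $H$. A graph $H$ has BEL gadgets if for every graph $G$ and every 2-coloring $\psi$ of the edges of $G$ without a monochromatic copy of $H$, there is a graph $F$ such that (1) $F\not\to H$, (2) $F$ contains $G$ as an induced subgraph, and (3) for every 2-coloring of the edges of $F$ without a monochromatic copy of $H$, its restriction to $G$ agrees with $\psi$ up to swapping the two colors. -}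

module Defs where

open import Data.Nat using (ℕ; zero; suc; _*_; _∸_; _≥_)
open import Data.Fin using (Fin; zero; suc)
open import Data.Bool using (Bool; true; false; not)
open import Data.List using (length; filterᵇ; allFin)
open import Data.Vec using (lookup)
open import Data.Fin.Subset using (Subset; _∈_; _⊆_; ∣_∣)
open import Data.Product using (Σ; ∃; _×_; _,_)
open import Data.Sum using (_⊎_)
open import Relation.Nullary using (¬_)
open import Relation.Binary.PropositionalEquality using (_≡_)
open import Function.Definitions using (Injective)

record Graph : Set where
  field
    n      : ℕ
    adj    : Fin n → Fin n → Bool
    sym    : ∀ u v → adj u v ≡ adj v u
    irrefl : ∀ v → adj v v ≡ false
open Graph public

Edge : (G : Graph) → Fin (n G) → Fin (n G) → Set
Edge G u v = adj G u v ≡ true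

deg : (G : Graph) → Fin (n G) → ℕ
deg G v = length (filterᵇ (adj G v) (allFin (n G)))

Regular : ℕ → Graph → Set
Regular d H = ∀ v → deg H v ≡ d

record Copy (H G : Graph) : Set where
  field
    f    : Fin (n H) → Fin (n G)
    inj  : Injective _≡_ _≡_ f
    hom  : ∀ u v → Edge H u v → Edge G (f u) (f v)

record InducedEmb (G' G : Graph) : Set where
  field
    f    : Fin (n G') → Fin (n G)
    inj  : Injective _≡_ _≡_ f
    pres : ∀ u v → adj G' u v ≡ adj G (f u) (f v)

-- 2-colouring of the edges of G (symmetric colour function; values on non-edges irrelevant)
record Colouring (G : Graph) : Set where
  field
    col  : Fin (n G) → Fin (n G) → Bool
    csym : ∀ u v → col u v ≡ col v u
open Colouring public

MonoCopy : (H G : Graph) → Colouring G → Set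
MonoCopy H G c = Σ Bool λ b → Σ (Copy H G) λ φ →
  ∀ u v → Edge H u v → col c (Copy.f φ u) (Copy.f φ v) ≡ b

NoMono : (H G : Graph) → Colouring G → Set
NoMono H G c = ¬ MonoCopy H G c

NotArrows : Graph → Graph → Set
NotArrows F H = Σ (Colouring F) λ c → NoMono H F c

HasBELGadgets : Graph → Set
HasBELGadgets H =
  (G : Graph) (ψ : Colouring G) → NoMono H G ψ →
  Σ Graph λ F → NotArrows F H × Σ (InducedEmb G F) λ e →
    (χ : Colouring F) → NoMono H F χ →
      (∀ u v → Edge G u v → col χ (InducedEmb.f e u) (InducedEmb.f e v) ≡ col ψ u v)
    ⊎ (∀ u v → Edge G u v → col χ (InducedEmb.f e u) (InducedEmb.f e v) ≡ not (col ψ u v))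

NbhdIndependent : (H : Graph) → Fin (n H) → Set
NbhdIndependent H v = ∀ u w → Edge H v u → Edge H v w → adj H u w ≡ false

Outside : (H : Graph) → Fin (n H) → Fin (n H) → Set
Outside H v u = ¬ (u ≡ v) × adj H v u ≡ false

data Reach (G : Graph) (P : Fin (n G) → Set) (u : Fin (n G)) : Fin (n G) → Set where
  here : P u → Reach G P u u
  step : ∀ {w x} → Reach G P u w → Edge G w x → P x → Reach G P u x

ConnectedOn : (G : Graph) → (Fin (n G) → Set) → Set
ConnectedOn G P = ∀ u w → P u → P w → Reach G P u w

IndependentSet : (G : Graph) → Subset (n G) → Set
IndependentSet G S = ∀ u w → u ∈ S → w ∈ S → adj G u w ≡ false

addAdj : ∀ {m} → (Fin m → Fin m → Bool) → Subset m → Fin (suc m) → Fin (suc m) → Bool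
addAdj a T zero    zero    = false
addAdj a T zero    (suc j) = lookup T j
addAdj a T (suc i) zero    = lookup T i
addAdj a T (suc i) (suc j) = a i j

addAdj-sym : (G : Graph) (T : Subset (n G)) → ∀ u v → addAdj (adj G) T u v ≡ addAdj (adj G) T v u
addAdj-sym G T zero zero = Relation.Binary.PropositionalEquality.refl
addAdj-sym G T zero (suc j) = Relation.Binary.PropositionalEquality.refl
addAdj-sym G T (suc i) zero = Relation.Binary.PropositionalEquality.refl
addAdj-sym G T (suc i) (suc j) = sym G i j

addAdj-irr : (G : Graph) (T : Subset (n G)) → ∀ v → addAdj (adj G) T v v ≡ false
addAdj-irr G T zero = Relation.Binary.PropositionalEquality.refl
addAdj-irr G T (suc i) = irrefl G i

addVertex : (G : Graph) → Subset (n G) → Graph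
addVertex G T = record
  { n = suc (n G) ; adj = addAdj (adj G) T
  ; sym = addAdj-sym G T ; irrefl = addAdj-irr G T }

module Submission where

-- S consists of 2d - 1 anchors. For every d-subset T of S, G contains a block:
-- a copy of H - v in which N(v) is identified with T by a fixed pairing, while H - v - N(v)
-- is a fresh copy. A new vertex joined to T then plays the role of v (module Apex).
--
-- Let φ be an injective homomorphism from H into G. A non-anchor block vertex
-- has at most d neighbours, so once φ hits it, φ hits all its neighbours (saturation). Using
-- the connectivity of H - v - N(v), and (for d ≥ 2) a second neighbour of each vertex of N(v),
-- φ hits the whole block of some T. Since |H| ≤ 1 + d + |H - v - N(v)| = 1 + |block|, at most
-- one vertex r of H is mapped outside the block. Every anchor of T has only d - 1 neighbours
-- inside the block, so each preimage of an anchor has a neighbour mapped outside it, namely r;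
-- but a common neighbour of all anchors of T lies in the block of T. For d = 1 the anchors are
-- isolated and a single block is too small to contain H (module NoCopy).

open import Defs hiding (sym)
open import Data.Nat using (ℕ; zero; suc; _+_; _*_; _∸_; _^_; _≤_; _<_; _≥_; z≤n; s≤s) renaming (_≟_ to _≟ℕ_)
open import Data.Nat.Properties using (+-suc; +-comm; ≤-reflexive; ≤-trans; ≤⇒≯; n<1+n; module ≤-Reasoning)
open import Data.Bool using (Bool; true; false; T?) renaming (_≟_ to _≟ᵇ_)
open import Data.Bool.Properties using (T-≡)
open import Data.Fin using (Fin; zero; suc; _↑ˡ_; _≟_)
open import Data.Fin.Properties using (suc-injective; +↔⊎; *↔×; 2↔Bool)
open import Data.Fin.Subset using (Subset; _⊆_; ∣_∣; ⊤; ⊥) renaming (_∈_ to _∈ₛ_)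
open import Data.Fin.Subset.Properties
  using (∉⊥; ∣⊥∣≡0; nonempty?; Empty-unique; ∣p∣≡n⇒p≡⊤; ⊆-antisym; p⊂q⇒∣p∣<∣q∣; drop-∷-⊆) renaming (_∈?_ to _∈ₛ?_)
open import Data.Vec using ([]; _∷_; here; there; lookup) renaming (_++_ to _++ᵥ_)
open import Data.Vec.Properties using ([]=⇒lookup) renaming (≡-dec to ≡-decᵥ)
open import Data.List using (List; []; _∷_; length; map; zip; _++_; filter; filterᵇ; allFin)
open import Data.List.Properties using (length-++; length-map; length-tabulate)
open import Data.List.Membership.Propositional using (_∈_; find; lose)
open import Data.List.Membership.Propositional.Properties
  using (∈-∃++; ∈-++⁻; ∈-++⁺ˡ; ∈-++⁺ʳ; ∈-map⁺; ∈-map⁻; ∈-filter⁺; ∈-filter⁻; ∈-allFin)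
open import Data.List.Relation.Unary.Any using (Any; here; there; any?)
open import Data.List.Relation.Unary.All using ([]; _∷_; all?)
import Data.List.Relation.Unary.All as All
open import Data.List.Relation.Unary.All.Properties.Core using (¬All⇒Any¬)
open import Data.List.Relation.Unary.AllPairs using ([]; _∷_)
open import Data.List.Relation.Unary.Unique.Propositional using (Unique)
open import Data.List.Relation.Unary.Unique.Propositional.Properties using (map⁺; filter⁺; allFin⁺; ++⁺)
open import Data.List.Relation.Binary.Subset.Propositional using () renaming (_⊆_ to _⊆ₗ_)
open import Data.Maybe using (Maybe; just; nothing)
open import Data.Product using (Σ; ∃; ∃₂; _×_; _,_; proj₁; proj₂; uncurry)
open import Data.Product.Properties using () renaming (≡-dec to ≡-dec×)
open import Data.Product.Function.NonDependent.Propositional using (_×-↔_)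
open import Data.Sum using (_⊎_; inj₁; inj₂)
open import Data.Sum.Properties using () renaming (≡-dec to ≡-dec⊎)
open import Data.Sum.Function.Propositional using (_⊎-↔_)
open import Data.Empty using (⊥-elim) renaming (⊥ to Empty)
open import Function using (_∘_)
open import Function.Bundles using (_↔_; mk↔ₛ′; Inverse; Injection; Equivalence)
open import Function.Definitions using (Injective)
open import Function.Properties.Inverse using (↔-refl; ↔-trans; ↔-sym; ↔⇒↣)
open import Relation.Binary using (DecidableEquality)
open import Relation.Binary.PropositionalEquality
  using (_≡_; _≢_; refl; sym; trans; cong; cong₂; subst; subst₂; module ≡-Reasoning)
open import Relation.Nullary using (¬_; Dec; does; yes; no; ¬?)
open import Relation.Nullary.Decidable using (dec-true; dec-false; _×-dec_)

unique-⊆⇒length≤ : {A : Set} {xs ys : List A} → Unique xs → xs ⊆ₗ ys → length xs ≤ length ys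
unique-⊆⇒length≤ {xs = []} _ _ = z≤n
unique-⊆⇒length≤ {xs = x ∷ xs} {ys} (x∉xs ∷ xs-unique) xs⊆ys with ∈-∃++ (xs⊆ys (here refl))
... | ys₁ , ys₂ , refl = begin
    suc (length xs)                ≤⟨ s≤s (unique-⊆⇒length≤ xs-unique xs⊆ys₁ys₂) ⟩
    suc (length (ys₁ ++ ys₂))      ≡⟨ cong suc (length-++ ys₁) ⟩
    suc (length ys₁ + length ys₂)  ≡⟨ sym (+-suc (length ys₁) (length ys₂)) ⟩
    length ys₁ + length (x ∷ ys₂)  ≡⟨ sym (length-++ ys₁) ⟩
    length (ys₁ ++ x ∷ ys₂)        ∎
  where
  open ≤-Reasoning
  xs⊆ys₁ys₂ : xs ⊆ₗ ys₁ ++ ys₂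
  xs⊆ys₁ys₂ y∈xs with ∈-++⁻ ys₁ (xs⊆ys (there y∈xs))
  ... | inj₁ y∈ys₁        = ∈-++⁺ˡ y∈ys₁
  ... | inj₂ (here refl)  = ⊥-elim (All.lookup x∉xs y∈xs refl)
  ... | inj₂ (there y∈ys₂) = ∈-++⁺ʳ ys₁ y∈ys₂

crowded : {A : Set} {xs ys : List A} {d : ℕ} → Unique xs → xs ⊆ₗ ys → length xs ≡ suc d → length ys ≡ d → Empty
crowded {d = d} xs-unique xs⊆ys length-xs length-ys =
  ≤⇒≯ (unique-⊆⇒length≤ xs-unique xs⊆ys) (subst₂ _<_ (sym length-ys) (sym length-xs) (n<1+n d))

module _ {A B : Set} where

  ∈-zip⁻ : {xs : List A} {ys : List B} {a : A} {b : B} → (a , b) ∈ zip xs ys → a ∈ xs × b ∈ ys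
  ∈-zip⁻ {x ∷ xs} {y ∷ ys} (here refl) = here refl , here refl
  ∈-zip⁻ {x ∷ xs} {y ∷ ys} (there p) with ∈-zip⁻ p
  ... | a∈xs , b∈ys = there a∈xs , there b∈ys

  zip-injectiveʳ : {xs : List A} {ys : List B} {a a' : A} {b : B} → Unique ys →
                   (a , b) ∈ zip xs ys → (a' , b) ∈ zip xs ys → a ≡ a'
  zip-injectiveʳ {x ∷ xs} {y ∷ ys} _ (here refl) (here refl) = refl
  zip-injectiveʳ {x ∷ xs} {y ∷ ys} (y∉ys ∷ _) (here refl) (there q) = ⊥-elim (All.lookup y∉ys (proj₂ (∈-zip⁻ q)) refl)
  zip-injectiveʳ {x ∷ xs} {y ∷ ys} (y∉ys ∷ _) (there p) (here refl) = ⊥-elim (All.lookup y∉ys (proj₂ (∈-zip⁻ p)) refl)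
  zip-injectiveʳ {x ∷ xs} {y ∷ ys} (_ ∷ ys-unique) (there p) (there q) = zip-injectiveʳ ys-unique p q

  zip-totalˡ : {xs : List A} {ys : List B} {a : A} → length xs ≤ length ys → a ∈ xs → ∃ λ b → (a , b) ∈ zip xs ys
  zip-totalˡ {x ∷ xs} {y ∷ ys} _ (here refl) = y , here refl
  zip-totalˡ {x ∷ xs} {y ∷ ys} (s≤s le) (there a∈xs) with zip-totalˡ le a∈xs
  ... | b , p = b , there p

  zip-totalʳ : {xs : List A} {ys : List B} {b : B} → length ys ≤ length xs → b ∈ ys → ∃ λ a → (a , b) ∈ zip xs ys
  zip-totalʳ {x ∷ xs} {y ∷ ys} _ (here refl) = x , here refl
  zip-totalʳ {x ∷ xs} {y ∷ ys} (s≤s le) (there b∈ys) with zip-totalʳ le b∈ys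
  ... | a , p = a , there p

  module _ (_≟A_ : DecidableEquality A) where

    assoc : A → List (A × B) → Maybe B
    assoc a [] = nothing
    assoc a ((a' , b) ∷ ps) with a ≟A a'
    ... | yes _ = just b
    ... | no _  = assoc a ps

    assoc-sound : (a : A) (ps : List (A × B)) {b : B} → assoc a ps ≡ just b → (a , b) ∈ ps
    assoc-sound a ((a' , b') ∷ ps) eq with a ≟A a'
    assoc-sound a ((a' , b') ∷ ps) refl | yes refl = here refl
    ... | no _ = there (assoc-sound a ps eq)

    assoc-zip : {xs : List A} {ys : List B} {a : A} {b : B} → Unique xs →
                (a , b) ∈ zip xs ys → assoc a (zip xs ys) ≡ just b
    assoc-zip {x ∷ xs} {y ∷ ys} {a} _ (here refl) with a ≟A a
    ... | yes _ = refl
    ... | no a≢a = ⊥-elim (a≢a refl)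
    assoc-zip {x ∷ xs} {y ∷ ys} {a} (x∉xs ∷ xs-unique) (there p) with a ≟A x
    ... | yes refl = ⊥-elim (All.lookup x∉xs (proj₁ (∈-zip⁻ p)) refl)
    ... | no _ = assoc-zip xs-unique p

elements : ∀ {m} → Subset m → List (Fin m)
elements []          = []
elements (true ∷ p)  = zero ∷ map suc (elements p)
elements (false ∷ p) = map suc (elements p)

∈-elements⁻ : ∀ {m} (p : Subset m) {s : Fin m} → s ∈ elements p → s ∈ₛ p
∈-elements⁻ (true ∷ p) (here refl) = here
∈-elements⁻ (true ∷ p) (there q) with ∈-map⁻ suc q
... | _ , r , refl = there (∈-elements⁻ p r)
∈-elements⁻ (false ∷ p) q with ∈-map⁻ suc q
... | _ , r , refl = there (∈-elements⁻ p r)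

∈-elements⁺ : ∀ {m} (p : Subset m) {s : Fin m} → s ∈ₛ p → s ∈ elements p
∈-elements⁺ (true ∷ p)  here      = here refl
∈-elements⁺ (true ∷ p)  (there q) = there (∈-map⁺ suc (∈-elements⁺ p q))
∈-elements⁺ (false ∷ p) (there q) = ∈-map⁺ suc (∈-elements⁺ p q)

elements-unique : ∀ {m} (p : Subset m) → Unique (elements p)
elements-unique []          = []
elements-unique (true ∷ p)  = All.tabulate zero∉ ∷ map⁺ suc-injective (elements-unique p)
  where
  zero∉ : ∀ {x} → x ∈ map suc (elements p) → zero ≢ x
  zero∉ q refl with ∈-map⁻ suc q
  ... | _ , _ , ()
elements-unique (false ∷ p) = map⁺ suc-injective (elements-unique p)

length-elements : ∀ {m} (p : Subset m) → length (elements p) ≡ ∣ p ∣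
length-elements []          = refl
length-elements (true ∷ p)  = cong suc (trans (length-map suc (elements p)) (length-elements p))
length-elements (false ∷ p) = trans (length-map suc (elements p)) (length-elements p)

subsetCode : ∀ m → Fin (2 ^ m) ↔ Subset m
subsetCode zero    = mk↔ₛ′ (λ _ → []) (λ _ → zero) (λ { [] → refl }) (λ { zero → refl })
subsetCode (suc m) = ↔-trans *↔× (↔-trans (2↔Bool ×-↔ subsetCode m) cons↔)
  where
  cons↔ : (Bool × Subset m) ↔ Subset (suc m)
  cons↔ = mk↔ₛ′ (uncurry _∷_) (λ { (b ∷ p) → b , p }) (λ { (b ∷ p) → refl }) (λ _ → refl)

_≟ₛ_ : ∀ {m} → DecidableEquality (Subset m)
_≟ₛ_ = ≡-decᵥ _≟ᵇ_

⊆-same-size : ∀ {m} {p q : Subset m} → p ⊆ q → ∣ q ∣ ≤ ∣ p ∣ → p ≡ q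
⊆-same-size {p = p} {q} p⊆q ∣q∣≤∣p∣ = ⊆-antisym p⊆q q⊆p
  where
  q⊆p : q ⊆ p
  q⊆p {x} x∈q with x ∈ₛ? p
  ... | yes x∈p = x∈p
  ... | no x∉p  = ⊥-elim (≤⇒≯ ∣q∣≤∣p∣ (p⊂q⇒∣p∣<∣q∣ (p⊆q , x , x∈q , x∉p)))

some-element : ∀ {m} (p : Subset m) → 1 ≤ ∣ p ∣ → ∃ λ s → s ∈ₛ p
some-element {m} p 1≤∣p∣ with nonempty? p
... | yes p-nonempty = p-nonempty
... | no p-empty with subst (1 ≤_) (trans (cong ∣_∣ (Empty-unique p-empty)) (∣⊥∣≡0 m)) 1≤∣p∣
...   | ()

prefix : ∀ m r → Subset (m + r)
prefix m r = ⊤ {m} ++ᵥ ⊥ {r}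

∣prefix∣ : ∀ m r → ∣ prefix m r ∣ ≡ m
∣prefix∣ zero    r = ∣⊥∣≡0 r
∣prefix∣ (suc m) r = cong suc (∣prefix∣ m r)

∈-prefix : ∀ m r {i : Fin (m + r)} → i ∈ₛ prefix m r → ∃ λ s → i ≡ s ↑ˡ r
∈-prefix zero    r i∈⊥        = ⊥-elim (∉⊥ i∈⊥)
∈-prefix (suc m) r here       = zero , refl
∈-prefix (suc m) r (there i∈) with ∈-prefix m r i∈
... | s , refl = suc s , refl

⊆-prefix : ∀ m r (p : Subset (m + r)) → p ⊆ prefix m r →
           Σ (Subset m) λ q → ∣ q ∣ ≡ ∣ p ∣ × (∀ {s} → s ∈ₛ q → s ↑ˡ r ∈ₛ p)
⊆-prefix zero r p p⊆⊥ = [] , sym (trans (cong ∣_∣ (⊆-antisym p⊆⊥ (λ x∈⊥ → ⊥-elim (∉⊥ x∈⊥)))) (∣⊥∣≡0 r)) , λ ()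
⊆-prefix (suc m) r (b ∷ p) bp⊆ with ⊆-prefix m r p (drop-∷-⊆ bp⊆)
⊆-prefix (suc m) r (true ∷ p) _ | q , ∣q∣ , q⊆ = true ∷ q , cong suc ∣q∣ , λ { here → here ; (there s∈q) → there (q⊆ s∈q) }
⊆-prefix (suc m) r (false ∷ p) _ | q , ∣q∣ , q⊆ = false ∷ q , ∣q∣ , λ { (there s∈q) → there (q⊆ s∈q) }

module Neighbourhood (G : Graph) where

  nbrs : Fin (n G) → List (Fin (n G))
  nbrs x = filterᵇ (adj G x) (allFin (n G))

  ∈-nbrs⁻ : ∀ {x y} → y ∈ nbrs x → Edge G x y
  ∈-nbrs⁻ {x} y∈ = Equivalence.to T-≡ (proj₂ (∈-filter⁻ (T? ∘ adj G x) {xs = allFin (n G)} y∈))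

  ∈-nbrs⁺ : ∀ {x y} → Edge G x y → y ∈ nbrs x
  ∈-nbrs⁺ {x} {y} xy = ∈-filter⁺ (T? ∘ adj G x) (∈-allFin y) (Equivalence.from T-≡ xy)

  nbrs-unique : ∀ x → Unique (nbrs x)
  nbrs-unique x = filter⁺ (T? ∘ adj G x) (allFin⁺ (n G))

  edge-sym : ∀ {x y} → Edge G x y → Edge G y x
  edge-sym {x} {y} xy = trans (Graph.sym G y x) xy

  edge-irrefl : ∀ {x} → ¬ Edge G x x
  edge-irrefl {x} xx with trans (sym xx) (irrefl G x)
  ... | ()

reach-end : ∀ {G : Graph} {P : Fin (n G) → Set} {u w} → Reach G P u w → P w
reach-end (here Pu)     = Pu
reach-end (step _ _ Pw) = Pw

some-neighbour : ∀ (G : Graph) {d} → Regular d G → 1 ≤ d → ∀ x → ∃ λ y → Edge G x y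
some-neighbour G reg 1≤d x = first (nbrs x) (subst (1 ≤_) (sym (reg x)) 1≤d) ∈-nbrs⁻
  where
  open Neighbourhood G
  first : (ys : List (Fin (n G))) → 1 ≤ length ys → (∀ {y} → y ∈ ys → Edge G x y) → ∃ λ y → Edge G x y
  first (y ∷ _) _ ys-nbrs = y , ys-nbrs (here refl)

another-neighbour : ∀ (G : Graph) {d} → Regular d G → 2 ≤ d → ∀ x a → ∃ λ y → Edge G x y × y ≢ a
another-neighbour G reg 2≤d x a = pick (nbrs x) (nbrs-unique x) (subst (2 ≤_) (sym (reg x)) 2≤d) ∈-nbrs⁻
  where
  open Neighbourhood G
  pick : (ys : List (Fin (n G))) → Unique ys → 2 ≤ length ys → (∀ {y} → y ∈ ys → Edge G x y) →
         ∃ λ y → Edge G x y × y ≢ a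
  pick (_ ∷ []) _ (s≤s ()) _
  pick (y ∷ y' ∷ _) ((y≢y' ∷ _) ∷ _) _ ys-nbrs with y ≟ a
  ... | no y≢a   = y , ys-nbrs (here refl) , y≢a
  ... | yes refl = y' , ys-nbrs (there (here refl)) , λ y'≡y → y≢y' (sym y'≡y)

module AroundVertex (G : Graph) (v : Fin (n G)) where
  open Neighbourhood G

  Outside? : ∀ w → Dec (Outside G v w)
  Outside? w = ¬? (w ≟ v) ×-dec (adj G v w ≟ᵇ false)

  outside : List (Fin (n G))
  outside = filter Outside? (allFin (n G))

  ∈-outside⁻ : ∀ {w} → w ∈ outside → Outside G v w
  ∈-outside⁻ w∈ = proj₂ (∈-filter⁻ Outside? {xs = allFin (n G)} w∈)

  ∈-outside⁺ : ∀ {w} → Outside G v w → w ∈ outside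
  ∈-outside⁺ {w} w-out = ∈-filter⁺ Outside? (∈-allFin w) w-out

  outside-unique : Unique outside
  outside-unique = filter⁺ Outside? (allFin⁺ (n G))

  outside-∉-nbrs : ∀ {w} → Outside G v w → ¬ (w ∈ nbrs v)
  outside-∉-nbrs (_ , ¬vw) w∈ with trans (sym ¬vw) (∈-nbrs⁻ w∈)
  ... | ()

  length-allFin : length (allFin (n G)) ≡ n G
  length-allFin = length-tabulate (λ x → x)

  -- every vertex is v, a neighbour of v, or outside
  order-≤ : n G ≤ suc (deg G v + length outside)
  order-≤ = subst (_≤ suc (deg G v + length outside)) length-allFin
              (subst (length (allFin (n G)) ≤_) (cong suc (length-++ (nbrs v)))
                (unique-⊆⇒length≤ (allFin⁺ (n G)) covered))
    where
    covered : allFin (n G) ⊆ₗ v ∷ (nbrs v ++ outside)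
    covered {x} _ with x ≟ v
    ... | yes refl = here refl
    ... | no x≢v with adj G v x in vx
    ...   | true  = there (∈-++⁺ˡ (∈-nbrs⁺ vx))
    ...   | false = there (∈-++⁺ʳ (nbrs v) (∈-outside⁺ (x≢v , vx)))

  -- v itself is not outside
  outside-< : length outside < n G
  outside-< = subst (length outside <_) length-allFin
                (unique-⊆⇒length≤ v∷outside-unique (λ {x} _ → ∈-allFin x))
    where
    v∷outside-unique : Unique (v ∷ outside)
    v∷outside-unique = All.tabulate (λ w∈ v≡w → proj₁ (∈-outside⁻ w∈) (sym v≡w)) ∷ outside-unique

module RelationGraph {V : Set} {N : ℕ} (code : Fin N ↔ V) (Adj : V → V → Set) (Adj? : ∀ a b → Dec (Adj a b))
                     (Adj-sym : ∀ {a b} → Adj a b → Adj b a) (Adj-irrefl : ∀ {a} → ¬ Adj a a) where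
  open Inverse code using (to; from; strictlyInverseˡ)

  to-injective : Injective _≡_ _≡_ to
  to-injective = Injection.injective (↔⇒↣ code)

  from-injective : Injective _≡_ _≡_ from
  from-injective = Injection.injective (↔⇒↣ (↔-sym code))

  does-sym : ∀ a b → does (Adj? a b) ≡ does (Adj? b a)
  does-sym a b with Adj? a b
  ... | yes ab = sym (dec-true (Adj? b a) (Adj-sym ab))
  ... | no ¬ab = sym (dec-false (Adj? b a) (¬ab ∘ Adj-sym))

  graph : Graph
  graph = record
    { n      = N
    ; adj    = λ i j → does (Adj? (to i) (to j))
    ; sym    = λ i j → does-sym (to i) (to j)
    ; irrefl = λ i → dec-false (Adj? (to i) (to i)) Adj-irrefl
    }

  edge⁻ : ∀ {i j} → Edge graph i j → Adj (to i) (to j)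
  edge⁻ {i} {j} ij with Adj? (to i) (to j)
  ... | yes a = a

  non-edge⁺ : ∀ {a b} → ¬ Adj a b → adj graph (from a) (from b) ≡ false
  non-edge⁺ {a} {b} ¬ab rewrite strictlyInverseˡ a | strictlyInverseˡ b = dec-false (Adj? a b) ¬ab

  edge⁺ : ∀ {a b} → Adj a b → Edge graph (from a) (from b)
  edge⁺ {a} {b} ab rewrite strictlyInverseˡ a | strictlyInverseˡ b = dec-true (Adj? a b) ab

  copy⇒hom : ∀ {H} → Copy H graph →
             Σ (Fin (n H) → V) λ φ → Injective _≡_ _≡_ φ × (∀ x y → Edge H x y → Adj (φ x) (φ y))
  copy⇒hom c = to ∘ Copy.f c , Copy.inj c ∘ to-injective , λ x y xy → edge⁻ (Copy.hom c x y xy)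

module Homomorphism {V : Set} (Adj : V → V → Set) (_≟V_ : DecidableEquality V)
                    (H : Graph) {d : ℕ} (reg : Regular d H)
                    (φ : Fin (n H) → V) (φ-inj : Injective _≡_ _≡_ φ)
                    (φ-hom : ∀ x y → Edge H x y → Adj (φ x) (φ y)) where
  open Neighbourhood H

  image-nbrs-unique : ∀ x → Unique (map φ (nbrs x))
  image-nbrs-unique x = map⁺ φ-inj (nbrs-unique x)

  length-image-nbrs : ∀ x → length (map φ (nbrs x)) ≡ d
  length-image-nbrs x = trans (length-map φ (nbrs x)) (reg x)

  saturated : ∀ {x b} → φ x ≡ b → (L : List V) → length L ≡ d → (∀ {c} → Adj b c → c ∈ L) →
              ∀ {c} → Adj b c → ∃ λ y → Edge H x y × φ y ≡ c
  saturated {x} refl L length-L L-covers {c} bc with any? (λ y → φ y ≟V c) (nbrs x)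
  ... | yes c-hit = let (y , y∈ , φy≡c) = find c-hit in y , ∈-nbrs⁻ y∈ , φy≡c
  ... | no c-missed = ⊥-elim (crowded c∷image-unique c∷image⊆L (cong suc (length-image-nbrs x)) length-L)
    where
    c∷image-unique : Unique (c ∷ map φ (nbrs x))
    c∷image-unique = All.tabulate c≢ ∷ image-nbrs-unique x
      where
      c≢ : ∀ {e} → e ∈ map φ (nbrs x) → c ≢ e
      c≢ e∈ refl with ∈-map⁻ φ e∈
      ... | y , y∈ , c≡φy = c-missed (lose y∈ (sym c≡φy))
    c∷image⊆L : c ∷ map φ (nbrs x) ⊆ₗ L
    c∷image⊆L (here refl) = L-covers bc
    c∷image⊆L (there e∈) with ∈-map⁻ φ e∈
    ... | y , y∈ , refl = L-covers (φ-hom x y (∈-nbrs⁻ y∈))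

  image : List V
  image = map φ (allFin (n H))

  ∈-image : ∀ x → φ x ∈ image
  ∈-image x = ∈-map⁺ φ (∈-allFin x)

  image-unique : Unique image
  image-unique = map⁺ φ-inj (allFin⁺ (n H))

  length-image : length image ≡ n H
  length-image = trans (length-map φ (allFin (n H))) (length-tabulate (λ x → x))

module Construction (H : Graph) (d : ℕ) (reg : Regular d H) (v : Fin (n H))
                    (indep : NbhdIndependent H v) (conn : ConnectedOn H (Outside H v)) where
  open Neighbourhood H
  open AroundVertex H v

  m : ℕ
  m = 2 * d ∸ 1

  -- Vertices of G: the anchors s ∈ Fin m (the independent set S), and a vertex (T , w)
  -- for every subset T of the anchors and every vertex w of H. Only the block vertices
  -- with |T| = d and w outside v and N(v) carry edges; the others are isolated.
  Vertex : Set
  Vertex = Fin m ⊎ (Subset m × Fin (n H))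

  pattern anchor s  = inj₁ s
  pattern block T w = inj₂ (T , w)

  _≟V_ : DecidableEquality Vertex
  _≟V_ = ≡-dec⊎ _≟_ (≡-dec× _≟ₛ_ _≟_)

  Active : Subset m → Fin (n H) → Set
  Active T w = ∣ T ∣ ≡ d × Outside H v w

  -- Within the block of T, the neighbours of v are identified with the anchors in T,
  -- by pairing the list N(v) with the list of elements of T.
  pairing : Subset m → List (Fin (n H) × Fin m)
  pairing T = zip (nbrs v) (elements T)

  -- u ∈ N(v) is paired with the anchor s ∈ T (a record, so that T is determined by the type).
  record Paired (T : Subset m) (u : Fin (n H)) (s : Fin m) : Set where
    constructor paired
    field pair∈ : (u , s) ∈ pairing T

  paired⇒nbr : ∀ {T u s} → Paired T u s → Edge H v u
  paired⇒nbr {T} (paired p) = ∈-nbrs⁻ (proj₁ (∈-zip⁻ {xs = nbrs v} {elements T} p))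

  paired⇒∈ : ∀ {T u s} → Paired T u s → s ∈ₛ T
  paired⇒∈ {T} (paired p) = ∈-elements⁻ T (proj₂ (∈-zip⁻ {xs = nbrs v} {elements T} p))

  paired-injective : ∀ {T u u' s} → Paired T u s → Paired T u' s → u ≡ u'
  paired-injective {T} (paired p) (paired q) = zip-injectiveʳ (elements-unique T) p q

  length-elements≡ : ∀ {T : Subset m} → ∣ T ∣ ≡ d → length (elements T) ≡ length (nbrs v)
  length-elements≡ {T} ∣T∣ = trans (length-elements T) (trans ∣T∣ (sym (reg v)))

  partnerˡ : ∀ {T : Subset m} {s} → ∣ T ∣ ≡ d → s ∈ₛ T → ∃ λ u → Paired T u s
  partnerˡ {T} ∣T∣ s∈T with zip-totalʳ (≤-reflexive (length-elements≡ {T} ∣T∣)) (∈-elements⁺ T s∈T)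
  ... | u , p = u , paired p

  partnerʳ : ∀ {T : Subset m} {u} → ∣ T ∣ ≡ d → Edge H v u → ∃ λ s → Paired T u s
  partnerʳ {T} ∣T∣ vu with zip-totalˡ (≤-reflexive (sym (length-elements≡ {T} ∣T∣))) (∈-nbrs⁺ vu)
  ... | s , p = s , paired p

  Attached : Subset m → Fin m → Fin (n H) → Set
  Attached T s w = Any (λ p → proj₂ p ≡ s × Edge H (proj₁ p) w) (pairing T)

  attached⁻ : ∀ {T s w} → Attached T s w → ∃ λ u → Paired T u s × Edge H u w
  attached⁻ att with find att
  ... | (u , _) , p , refl , uw = u , paired p , uw

  attached⁺ : ∀ {T s u w} → Paired T u s → Edge H u w → Attached T s w
  attached⁺ (paired p) uw = lose p (refl , uw)

  Adj : Vertex → Vertex → Set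
  Adj (anchor _)  (anchor _)    = Empty
  Adj (anchor s)  (block T w)   = Active T w × Attached T s w
  Adj (block T w) (anchor s)    = Active T w × Attached T s w
  Adj (block T w) (block T' w') = T ≡ T' × Active T w × Active T' w' × Edge H w w'

  Active? : ∀ T w → Dec (Active T w)
  Active? T w = (∣ T ∣ ≟ℕ d) ×-dec Outside? w

  Attached? : ∀ T s w → Dec (Attached T s w)
  Attached? T s w = any? (λ p → (proj₂ p ≟ s) ×-dec (adj H (proj₁ p) w ≟ᵇ true)) (pairing T)

  Adj? : ∀ a b → Dec (Adj a b)
  Adj? (anchor _)  (anchor _)    = no λ ()
  Adj? (anchor s)  (block T w)   = Active? T w ×-dec Attached? T s w
  Adj? (block T w) (anchor s)    = Active? T w ×-dec Attached? T s w
  Adj? (block T w) (block T' w') =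
    (T ≟ₛ T') ×-dec Active? T w ×-dec Active? T' w' ×-dec (adj H w w' ≟ᵇ true)

  Adj-sym : ∀ {a b} → Adj a b → Adj b a
  Adj-sym {anchor _}  {block _ _} ab = ab
  Adj-sym {block _ _} {anchor _}  ab = ab
  Adj-sym {block _ _} {block _ _} (T≡T' , aw , aw' , ww') = sym T≡T' , aw' , aw , edge-sym ww'

  Adj-irrefl : ∀ {a} → ¬ Adj a a
  Adj-irrefl {block _ _} (_ , _ , _ , ww) = edge-irrefl ww

  -- G has m + R vertices: the anchors first, then the 2 ^ m · n H block vertices.
  R : ℕ
  R = 2 ^ m * n H

  code : Fin (m + R) ↔ Vertex
  code = ↔-trans +↔⊎ (↔-refl ⊎-↔ (↔-trans *↔× (subsetCode m ×-↔ ↔-refl)))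

  open RelationGraph code Adj Adj? Adj-sym Adj-irrefl
  open Inverse code using (from)

  G : Graph
  G = graph

  S : Subset (n G)
  S = prefix m R

  S-independent : IndependentSet G S
  S-independent i j i∈S j∈S with ∈-prefix m R i∈S | ∈-prefix m R j∈S
  ... | s , refl | s' , refl = non-edge⁺ {anchor s} {anchor s'} λ ()

  -- A neighbour other than v of a vertex of N(v) lies outside v and N(v), as N(v) is independent.
  outside-of-nbr : ∀ {u w} → Edge H v u → Edge H u w → w ≢ v → Outside H v w
  outside-of-nbr {u} {w} vu uw w≢v with adj H v w in vw
  ... | false = w≢v , refl
  ... | true with trans (sym (indep u w vu vw)) uw
  ...   | ()

  -- The block of T as a picture of H - v: a neighbour of v goes to its paired anchor,
  -- every other vertex w to the block vertex (T , w).
  place : Subset m → Fin (n H) → Vertex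
  place T y with assoc _≟_ y (pairing T)
  ... | just s  = anchor s
  ... | nothing = block T y

  place-paired : ∀ {T u s} → Paired T u s → place T u ≡ anchor s
  place-paired {T} {u} (paired p) with assoc _≟_ u (pairing T) | assoc-zip _≟_ (nbrs-unique v) p
  ... | just _ | refl = refl

  place-outside : ∀ {T w} → Outside H v w → place T w ≡ block T w
  place-outside {T} {w} w-out with assoc _≟_ w (pairing T) in found
  ... | nothing = refl
  ... | just _  = ⊥-elim (outside-∉-nbrs w-out
                    (proj₁ (∈-zip⁻ {xs = nbrs v} {elements T} (assoc-sound _≟_ w (pairing T) found))))

  -- An active block vertex (T , w) has all its neighbours among the places of N(w);
  -- in particular it has at most d neighbours.
  block-nbrs : ∀ {T w c} → Adj (block T w) c → c ∈ map (place T) (nbrs w)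
  block-nbrs {T} {w} {anchor s} (_ , att) with attached⁻ att
  ... | u , p , uw = subst (_∈ map (place T) (nbrs w)) (place-paired p) (∈-map⁺ (place T) (∈-nbrs⁺ (edge-sym uw)))
  block-nbrs {T} {w} {block _ w'} (refl , _ , (_ , w'-out) , ww') =
    subst (_∈ map (place T) (nbrs w)) (place-outside w'-out) (∈-map⁺ (place T) (∈-nbrs⁺ ww'))

  block-active : ∀ {T w c} → Adj (block T w) c → Active T w
  block-active {c = anchor _}  (aw , _)     = aw
  block-active {c = block _ _} (_ , aw , _) = aw

  module Apex (T : Subset m) (∣T∣ : ∣ T ∣ ≡ d) where

    classify : ∀ {x} → x ≢ v → (∃ λ s → Paired T x s) ⊎ Outside H v x
    classify {x} x≢v with adj H v x in vx
    ... | true  = inj₁ (partnerʳ ∣T∣ vx)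
    ... | false = inj₂ (x≢v , refl)

    place-hom : ∀ {x y} → x ≢ v → y ≢ v → Edge H x y → Adj (place T x) (place T y)
    place-hom x≢v y≢v xy with classify x≢v | classify y≢v
    ... | inj₁ (_ , p) | inj₁ (_ , q) with trans (sym (indep _ _ (paired⇒nbr p) (paired⇒nbr q))) xy
    ...   | ()
    place-hom x≢v y≢v xy | inj₁ (_ , p) | inj₂ y-out =
      subst₂ Adj (sym (place-paired p)) (sym (place-outside y-out)) ((∣T∣ , y-out) , attached⁺ p xy)
    place-hom x≢v y≢v xy | inj₂ x-out | inj₁ (_ , q) =
      subst₂ Adj (sym (place-outside x-out)) (sym (place-paired q)) ((∣T∣ , x-out) , attached⁺ q (edge-sym xy))
    place-hom x≢v y≢v xy | inj₂ x-out | inj₂ y-out =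
      subst₂ Adj (sym (place-outside x-out)) (sym (place-outside y-out)) (refl , (∣T∣ , x-out) , (∣T∣ , y-out) , xy)

    -- places of distinct vertices differ, since the pairing is injective
    place-injective : ∀ {x y} → x ≢ v → y ≢ v → place T x ≡ place T y → x ≡ y
    place-injective x≢v y≢v eq with classify x≢v | classify y≢v
    ... | inj₁ (_ , p) | inj₁ (_ , q) with trans (sym (place-paired p)) (trans eq (place-paired q))
    ...   | refl = paired-injective p q
    place-injective x≢v y≢v eq | inj₁ (_ , p) | inj₂ y-out
      with trans (sym (place-paired p)) (trans eq (place-outside y-out))
    ... | ()
    place-injective x≢v y≢v eq | inj₂ x-out | inj₁ (_ , q)
      with trans (sym (place-outside x-out)) (trans eq (place-paired q))
    ... | ()
    place-injective x≢v y≢v eq | inj₂ x-out | inj₂ y-out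
      with trans (sym (place-outside x-out)) (trans eq (place-outside y-out))
    ... | refl = refl

    place-nbr : ∀ {y} → Edge H v y → ∃ λ s → s ∈ₛ T × place T y ≡ anchor s
    place-nbr vy with partnerʳ ∣T∣ vy
    ... | s , p = s , paired⇒∈ p , place-paired p

    copy : (S' : Subset (n G)) → (∀ {s} → s ∈ₛ T → from (anchor s) ∈ₛ S') → Copy H (addVertex G S')
    copy S' T⊆S' = record { f = f ; inj = f-injective ; hom = f-hom }
      where
      f : Fin (n H) → Fin (suc (n G))
      f x with x ≟ v
      ... | yes _ = zero
      ... | no _  = suc (from (place T x))

      f-injective : Injective _≡_ _≡_ f
      f-injective {x} {y} eq with x ≟ v | y ≟ v
      ... | yes refl | yes refl = refl
      ... | no x≢v   | no y≢v   =
        place-injective x≢v y≢v (from-injective (suc-injective eq))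
      f-injective () | yes _ | no _
      f-injective () | no _  | yes _

      joined-to-new : ∀ {y} → Edge H v y → lookup S' (from (place T y)) ≡ true
      joined-to-new vy with place-nbr vy
      ... | s , s∈T , placed =
        subst (λ a → lookup S' (from a) ≡ true) (sym placed) ([]=⇒lookup (T⊆S' s∈T))

      f-hom : ∀ x y → Edge H x y → Edge (addVertex G S') (f x) (f y)
      f-hom x y xy with x ≟ v | y ≟ v
      ... | yes refl | yes refl = ⊥-elim (edge-irrefl xy)
      ... | yes refl | no y≢v   = joined-to-new xy
      ... | no x≢v   | yes refl = joined-to-new (edge-sym xy)
      ... | no x≢v   | no y≢v   = edge⁺ (place-hom x≢v y≢v xy)

  InBlock : Subset m → Vertex → Set
  InBlock T (anchor s)    = s ∈ₛ T
  InBlock T (block T' w)  = T' ≡ T × Outside H v w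

  InBlock? : ∀ T c → Dec (InBlock T c)
  InBlock? T (anchor s)   = s ∈ₛ? T
  InBlock? T (block T' w) = _≟ₛ_ T' T ×-dec Outside? w

  blockList : Subset m → List Vertex
  blockList T = map (block T) outside ++ map anchor (elements T)

  ∈-blockList⁻ : ∀ {T c} → c ∈ blockList T → InBlock T c
  ∈-blockList⁻ {T} c∈ with ∈-++⁻ (map (block T) outside) c∈
  ... | inj₁ c∈blocks with ∈-map⁻ (block T) c∈blocks
  ...   | w , w∈ , refl = refl , ∈-outside⁻ w∈
  ∈-blockList⁻ {T} c∈ | inj₂ c∈anchors with ∈-map⁻ anchor c∈anchors
  ...   | s , s∈ , refl = ∈-elements⁻ T s∈

  blockList-unique : ∀ T → Unique (blockList T)
  blockList-unique T =
    ++⁺ (map⁺ block-injective outside-unique) (map⁺ anchor-injective (elements-unique T)) disjoint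
    where
    block-injective : ∀ {w w'} → block T w ≡ block T w' → w ≡ w'
    block-injective refl = refl
    anchor-injective : ∀ {s s' : Fin m} → _≡_ {A = Vertex} (anchor s) (anchor s') → s ≡ s'
    anchor-injective refl = refl
    disjoint : ∀ {c} → c ∈ map (block T) outside × c ∈ map anchor (elements T) → Empty
    disjoint (c∈blocks , c∈anchors) with ∈-map⁻ (block T) c∈blocks | ∈-map⁻ anchor c∈anchors
    ... | _ , _ , refl | _ , _ , ()

  length-blockList : ∀ {T} → ∣ T ∣ ≡ d → length (blockList T) ≡ length outside + d
  length-blockList {T} ∣T∣ = begin
    length (blockList T)
      ≡⟨ length-++ (map (block T) outside) ⟩
    length (map (block T) outside) + length (map anchor (elements T))
      ≡⟨ cong₂ _+_ (length-map (block T) outside) (length-map anchor (elements T)) ⟩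
    length outside + length (elements T)
      ≡⟨ cong (length outside +_) (trans (length-elements T) ∣T∣) ⟩
    length outside + d
      ∎
    where open ≡-Reasoning

  anchor-nbr-in-block : ∀ {T u s c} → Paired T u s → Adj (anchor s) c → InBlock T c →
                        c ∈ map (block T) (nbrs u)
  anchor-nbr-in-block {c = block _ w} p (_ , att) (refl , _) with attached⁻ att
  ... | u' , p' , u'w with paired-injective p' p
  ...   | refl = ∈-map⁺ (block _) (∈-nbrs⁺ u'w)

  -- A common neighbour of all anchors in a nonempty d-set T lies in the block of T: it is
  -- some (T' , w) with T ⊆ T', and |T'| = d forces T' = T.
  common-nbr-in-block : ∀ {T s₀ c} → s₀ ∈ₛ T → ∣ T ∣ ≡ d → (∀ {s} → s ∈ₛ T → Adj (anchor s) c) →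
                        InBlock T c
  common-nbr-in-block {c = anchor _} s₀∈T _ all-adj = ⊥-elim (all-adj s₀∈T)
  common-nbr-in-block {T} {c = block T' w} s₀∈T ∣T∣ all-adj =
    sym (⊆-same-size T⊆T' (≤-reflexive (trans ∣T'∣ (sym ∣T∣)))) , w-out
    where
    ∣T'∣ : ∣ T' ∣ ≡ d
    ∣T'∣ = proj₁ (proj₁ (all-adj s₀∈T))
    w-out : Outside H v w
    w-out = proj₂ (proj₁ (all-adj s₀∈T))
    T⊆T' : T ⊆ T'
    T⊆T' s∈T with attached⁻ (proj₂ (all-adj s∈T))
    ... | _ , p , _ = paired⇒∈ p

  module NoCopy (φ : Fin (n H) → Vertex) (φ-inj : Injective _≡_ _≡_ φ)
                (φ-hom : ∀ x y → Edge H x y → Adj (φ x) (φ y)) where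
    open Homomorphism Adj _≟V_ H reg φ φ-inj φ-hom

    -- An active block vertex has at most d neighbours, so in the image of a d-regular
    -- graph all of them are images of neighbours.
    block-saturated : ∀ {x T w c} → φ x ≡ block T w → Adj (block T w) c →
                      ∃ λ y → Edge H x y × φ y ≡ c
    block-saturated {T = T} {w} φx =
      saturated φx (map (place T) (nbrs w)) (trans (length-map (place T) (nbrs w)) (reg w)) block-nbrs

    edge-at-block : ∀ {a c} → Adj a c → ∃₂ λ T w → (a ≡ block T w ⊎ c ≡ block T w) × Active T w
    edge-at-block {anchor _}  {block T w} (aw , _) = T , w , inj₂ refl , aw
    edge-at-block {block T w} {_}         ac       = T , w , inj₁ refl , block-active ac

    -- Some edge of H, hence some vertex of H, is mapped onto an active block vertex.
    meets-block : 1 ≤ d → ∃ λ x → ∃₂ λ T w → φ x ≡ block T w × Active T w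
    meets-block 1≤d with some-neighbour H reg 1≤d v
    ... | u , vu with edge-at-block (φ-hom v u vu)
    ...   | T , w , inj₁ φv , aw = v , T , w , φv , aw
    ...   | T , w , inj₂ φu , aw = u , T , w , φu , aw

    module Block {x₀ T w₀} (φx₀ : φ x₀ ≡ block T w₀) (a₀ : Active T w₀) (2≤d : 2 ≤ d) where
      ∣T∣ : ∣ T ∣ ≡ d
      ∣T∣ = proj₁ a₀

      -- by connectivity of H - v - N(v)
      block-covered : ∀ {w} → Outside H v w → ∃ λ x → φ x ≡ block T w
      block-covered w-out = walk (conn _ _ (proj₂ a₀) w-out)
        where
        walk : ∀ {w} → Reach H (Outside H v) w₀ w → ∃ λ x → φ x ≡ block T w
        walk (here _) = x₀ , φx₀
        walk (step r w₁w₂ w₂-out) with walk r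
        ... | x₁ , φx₁ with block-saturated φx₁ (refl , (∣T∣ , reach-end r) , (∣T∣ , w₂-out) , w₁w₂)
        ...   | y , _ , φy = y , φy

      -- each s ∈ T is attached to some (T , w) with w outside, as its partner has a neighbour besides v
      anchor-covered : ∀ {s} → s ∈ₛ T → ∃ λ y → φ y ≡ anchor s
      anchor-covered s∈T with partnerˡ ∣T∣ s∈T
      ... | u , p with another-neighbour H reg 2≤d u v
      ...   | w , uw , w≢v with outside-of-nbr (paired⇒nbr p) uw w≢v
      ...     | w-out with block-covered w-out
      ...       | x , φx with block-saturated φx ((∣T∣ , w-out) , attached⁺ p uw)
      ...         | y , _ , φy = y , φy

      block-in-image : blockList T ⊆ₗ image
      block-in-image c∈ with ∈-++⁻ (map (block T) outside) c∈
      ... | inj₁ c∈blocks with ∈-map⁻ (block T) c∈blocks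
      ...   | w , w∈ , refl = subst (_∈ image) (proj₂ (block-covered (∈-outside⁻ w∈))) (∈-image _)
      block-in-image c∈ | inj₂ c∈anchors with ∈-map⁻ anchor c∈anchors
      ...   | s , s∈ , refl = subst (_∈ image) (proj₂ (anchor-covered (∈-elements⁻ T s∈))) (∈-image _)

      -- A preimage y of an anchor of T has a neighbour mapped outside the block: inside the
      -- block, anchor s has only d - 1 neighbours (T , w), w ∈ N(u) - v.
      escapes : ∀ {s y} → s ∈ₛ T → φ y ≡ anchor s → ∃ λ z → Edge H y z × ¬ InBlock T (φ z)
      escapes {s} {y} s∈T φy with partnerˡ ∣T∣ s∈T | all? (λ z → InBlock? T (φ z)) (nbrs y)
      ... | _ | no some-out with find (¬All⇒Any¬ (λ z → InBlock? T (φ z)) (nbrs y) some-out)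
      ...   | z , z∈ , z-out = z , ∈-nbrs⁻ z∈ , z-out
      escapes {s} {y} s∈T φy | u , p | yes all-in =
        ⊥-elim (crowded L-unique L⊆ (cong suc (length-image-nbrs y))
                                    (trans (length-map (block T) (nbrs u)) (reg u)))
        where
        L : List Vertex
        L = block T v ∷ map φ (nbrs y)
        v-not-out : ¬ InBlock T (block T v)
        v-not-out (_ , v≢v , _) = v≢v refl
        L-unique : Unique L
        L-unique = All.tabulate v∉ ∷ image-nbrs-unique y
          where
          v∉ : ∀ {c} → c ∈ map φ (nbrs y) → block T v ≢ c
          v∉ c∈ refl with ∈-map⁻ φ c∈
          ... | z , z∈ , φz = v-not-out (subst (InBlock T) (sym φz) (All.lookup all-in z∈))
        L⊆ : L ⊆ₗ map (block T) (nbrs u)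
        L⊆ (here refl) = ∈-map⁺ (block T) (∈-nbrs⁺ (edge-sym (paired⇒nbr p)))
        L⊆ (there c∈) with ∈-map⁻ φ c∈
        ... | z , z∈ , refl =
          anchor-nbr-in-block p (subst (λ a → Adj a (φ z)) φy (φ-hom y z (∈-nbrs⁻ z∈))) (All.lookup all-in z∈)

      -- The image has n H ≤ 1 + d + |outside| vertices and contains the whole block
      -- (|outside| + d vertices), so at most one vertex of H is mapped outside the block.
      unique-escape : ∀ {z r} → ¬ InBlock T (φ z) → ¬ InBlock T (φ r) → z ≡ r
      unique-escape {z} {r} z-out r-out with z ≟ r
      ... | yes z≡r = z≡r
      ... | no z≢r  = ⊥-elim (≤⇒≯ small large)
        where
        L : List Vertex
        L = φ z ∷ φ r ∷ blockList T
        ∉block : ∀ {a} → ¬ InBlock T a → ∀ {c} → c ∈ blockList T → a ≢ c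
        ∉block a-out c∈ refl = a-out (∈-blockList⁻ c∈)
        L-unique : Unique L
        L-unique = ((z≢r ∘ φ-inj) ∷ All.tabulate (∉block z-out))
                 ∷ All.tabulate (∉block r-out) ∷ blockList-unique T
        L⊆ : L ⊆ₗ image
        L⊆ (here refl)         = ∈-image z
        L⊆ (there (here refl)) = ∈-image r
        L⊆ (there (there c∈))  = block-in-image c∈
        large : suc (suc (length outside + d)) ≤ n H
        large = subst₂ _≤_ (cong (λ k → suc (suc k)) (length-blockList {T} ∣T∣)) length-image
                  (unique-⊆⇒length≤ L-unique L⊆)
        small : n H ≤ suc (length outside + d)
        small = subst (n H ≤_) (cong suc (trans (cong (_+ length outside) (reg v)) (+-comm d (length outside))))
                  order-≤

      -- So the escaping neighbours of all preimages of anchors of T coincide in one vertex r,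
      -- a common neighbour of the anchors of T outside their block: impossible.
      contradiction : Empty
      contradiction with some-element T (≤-trans (s≤s z≤n) (subst (2 ≤_) (sym ∣T∣) 2≤d))
      ... | s₀ , s₀∈T with anchor-covered s₀∈T
      ...   | y₀ , φy₀ with escapes s₀∈T φy₀
      ...     | r , _ , r-out = r-out (common-nbr-in-block s₀∈T ∣T∣ all-adj)
        where
        all-adj : ∀ {s} → s ∈ₛ T → Adj (anchor s) (φ r)
        all-adj s∈T with anchor-covered s∈T
        ... | y , φy with escapes s∈T φy
        ...   | z , yz , z-out with unique-escape z-out r-out
        ...     | refl = subst (λ a → Adj a (φ z)) φy (φ-hom y z yz)

    -- For d = 1 the anchors are isolated (a partner of an anchor would need two neighbours),
    -- and all of H lands in the single block T = ⊤, which has fewer than n H vertices.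
    module DegreeOne (d≡1 : d ≡ 1) where
      d≡m : d ≡ m
      d≡m = trans d≡1 (sym (cong (λ k → 2 * k ∸ 1) d≡1))

      -- full is the only d-subset of the m = 1 anchors
      full : Subset m
      full = ⊤

      anchor-isolated : ∀ {s c} → ¬ Adj (anchor s) c
      anchor-isolated {c = block T w} ((_ , w≢v , _) , att) with attached⁻ {T} att
      ... | u , p , uw = crowded w∷v-unique w∷v⊆ refl (trans (reg u) d≡1)
        where
        w∷v-unique : Unique (w ∷ v ∷ [])
        w∷v-unique = (w≢v ∷ []) ∷ [] ∷ []
        w∷v⊆ : w ∷ v ∷ [] ⊆ₗ nbrs u
        w∷v⊆ (here refl)         = ∈-nbrs⁺ uw
        w∷v⊆ (there (here refl)) = ∈-nbrs⁺ (edge-sym (paired⇒nbr p))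

      all-in-full-block : ∀ x → φ x ∈ map (block full) outside
      all-in-full-block x with some-neighbour H reg (≤-reflexive (sym d≡1)) x
      ... | y , xy with φ x | φ-hom x y xy
      ...   | anchor s  | φxφy = ⊥-elim (anchor-isolated φxφy)
      ...   | block T w | φxφy with block-active φxφy
      ...     | ∣T∣ , w-out =
        subst (λ T' → block T' w ∈ map (block full) outside) (sym (∣p∣≡n⇒p≡⊤ (trans ∣T∣ d≡m)))
          (∈-map⁺ (block full) (∈-outside⁺ w-out))

      -- the n H distinct images fit among the fewer than n H vertices of one block
      contradiction : Empty
      contradiction = ≤⇒≯ (subst₂ _≤_ length-image (length-map (block full) outside) image-fits) outside-<
        where
        image⊆block : image ⊆ₗ map (block full) outside
        image⊆block c∈ with ∈-map⁻ φ c∈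
        ... | x , _ , refl = all-in-full-block x
        image-fits : length image ≤ length (map (block full) outside)
        image-fits = unique-⊆⇒length≤ image-unique image⊆block

    no-hom : 1 ≤ d → Empty
    no-hom 1≤d with d ≟ℕ 1 | meets-block 1≤d
    ... | yes d≡1 | _ = DegreeOne.contradiction d≡1
    ... | no d≢1  | _ , _ , _ , φx₀ , a₀ = Block.contradiction φx₀ a₀ (2≤ 1≤d d≢1)
      where
      2≤ : ∀ {k} → 1 ≤ k → k ≢ 1 → 2 ≤ k
      2≤ {suc zero}    _ k≢1 = ⊥-elim (k≢1 refl)
      2≤ {suc (suc _)} _ _   = s≤s (s≤s z≤n)

  no-copy : 1 ≤ d → ¬ Copy H G
  no-copy 1≤d c with copy⇒hom c
  ... | φ , φ-inj , φ-hom = NoCopy.no-hom φ φ-inj φ-hom 1≤d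

lemma4p3 : (d : ℕ) → d ≥ 1 → (H : Graph) → Regular d H → HasBELGadgets H →
    (v : Fin (n H)) → NbhdIndependent H v → ConnectedOn H (Outside H v) →
    Σ Graph λ G → ¬ Copy H G × Σ (Subset (n G)) λ S →
    IndependentSet G S × ∣ S ∣ ≡ 2 * d ∸ 1 ×
    ((S' : Subset (n G)) → S' ⊆ S → ∣ S' ∣ ≡ d → Copy H (addVertex G S'))
lemma4p3 d 1≤d H reg _ v indep conn = G , no-copy 1≤d , S , S-independent , ∣prefix∣ m R , copies
  where
  open Construction H d reg v indep conn

  -- a d-subset S' of S is the set of anchors of a d-subset T, and the new vertex plays v
  copies : (S' : Subset (n G)) → S' ⊆ S → ∣ S' ∣ ≡ d → Copy H (addVertex G S')
  copies S' S'⊆S ∣S'∣ with ⊆-prefix m R S' S'⊆S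
  ... | T , ∣T∣ , T⊆S' = Apex.copy T (trans ∣T∣ ∣S'∣) S' T⊆S'
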